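{- Let $\Upsilon=(G=(V_G,E_G),\pi,[k])$ be a satisfiable label cover instance (i.e., some labeling satisfies every edge constraint), and let $\Gamma=(\tilde G,\tilde H)$ be any instance produced by the reduction described below. Then there exists an injective map $\varphi:V_{\tilde G}\to V_{\tilde H}$ that maps every edge of $\tilde G$ to an edge of $\tilde H$. Thus $\mathrm{OPT}_{QAP}(\Gamma)=|E_{\tilde G}|$.
   Context: A label cover instance $\Upsilon=(G=(V_G,E_G),\pi,[k])$ consists of a graph $G$ with $n=|V_G|$, a label set $[k]=\{0,\dots,k-1\}$, and for each edge $(u,v)\in E_G$ a set $\pi_{uv}\subseteq[k]\times[k]$ of accepted label pairs; a labeling $\Lambda:V_G\to[k]$ satisfies edge $(u,v)$ if $(\Lambda(u),\Lambda(v))\in\pi_{uv}$. The reduction: $N=\lceil n^4|E_G|k^5\rceil$, $\alpha=1/n$, $V_{\tilde G}=V_G\times[N]$, $V_{\tilde H}=V_G\times[k]\times[N]$; for each edge $(u,v)$ of $G$ a random $\mathcal{E}_{uv}\subseteq[N]\times[N]$ containing each pair independently with probability $\alpha$; $E_{\tilde G}=\{((u,i),(v,j)):(u,v)\in E_G,(i,j)\in\mathcal{E}_{uv}\}$, $E_{\tilde H}=\{((u,x,i),(v,y,j)):(u,v)\in E_G,(i,j)\in\mathcal{E}_{uv},(x,y)\in\pi_{uv}\}$. For unweighted graphs with $|V_{\tilde G}|\le|V_{\tilde H}|$, feasible solutions are injective maps $\varphi:V_{\tilde G}\to V_{\tilde H}$ with value $\mathrm{VALUE}_{QAP}(\Gamma,\varphi)=\sum_{(a,b)\in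 E_{\tilde G}}\mathbf{1}((\varphi(a),\varphi(b))\in E_{\tilde H})$, and $\mathrm{OPT}_{QAP}(\Gamma)$ is the maximum value. -}

module Defs where

open import Data.Nat using (ℕ; _+_; _*_; _^_)
open import Data.Bool using (Bool; true; false; _∧_; if_then_else_)
open import Data.Fin using (Fin)
open import Data.List using (List; map; allFin; cartesianProduct)
open import Data.Nat.ListAction using (sum)
open import Data.Product using (_×_; _,_)
open import Function.Definitions using (Injective)
open import Relation.Binary.PropositionalEquality using (_≡_)

pairsFin : (a b : ℕ) → List (Fin a × Fin b)
pairsFin a b = cartesianProduct (allFin a) (allFin b)

triplesFin : (a b c : ℕ) → List (Fin a × Fin b × Fin c)
triplesFin a b c = cartesianProduct (allFin a) (pairsFin b c)

countL : {A : Set} → (A → Bool) → List A → ℕ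
countL p xs = sum (map (λ x → if p x then 1 else 0) xs)

countRel : {A : Set} → List A → (A → A → Bool) → ℕ
countRel xs R = countL (λ xy → R (Data.Product.proj₁ xy) (Data.Product.proj₂ xy))
                       (cartesianProduct xs xs)

-- A graph on vertex set Fin n: E u v = true iff (u , v) ∈ E_G.
-- Label cover constraints: π u v x y = true iff (x , y) ∈ π_uv.

numEdges : (n : ℕ) → (Fin n → Fin n → Bool) → ℕ
numEdges n E = countRel (allFin n) E

Satisfiable : (n k : ℕ) → (Fin n → Fin n → Bool) →
              (Fin n → Fin n → Fin k → Fin k → Bool) → Set
Satisfiable n k E π =
  Data.Product.∃ λ (Λ : Fin n → Fin k) →
    ∀ u v → E u v ≡ true → π u v (Λ u) (Λ v) ≡ true

-- N = ⌈ n^4 |E_G| k^5 ⌉ (an integer already)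
redN : (n k : ℕ) → (Fin n → Fin n → Bool) → ℕ
redN n k E = n ^ 4 * numEdges n E * k ^ 5

VG̃ : (n N : ℕ) → Set
VG̃ n N = Fin n × Fin N

VH̃ : (n k N : ℕ) → Set
VH̃ n k N = Fin n × Fin k × Fin N

-- Edge set of G̃ given the random sets 𝓔 u v ⊆ [N] × [N]
EG̃ : {n N : ℕ} → (Fin n → Fin n → Bool) → (Fin n → Fin n → Fin N → Fin N → Bool) →
     VG̃ n N → VG̃ n N → Bool
EG̃ E 𝓔 (u , i) (v , j) = E u v ∧ 𝓔 u v i j

EH̃ : {n k N : ℕ} → (Fin n → Fin n → Bool) → (Fin n → Fin n → Fin k → Fin k → Bool) →
     (Fin n → Fin n → Fin N → Fin N → Bool) → VH̃ n k N → VH̃ n k N → Bool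
EH̃ E π 𝓔 (u , x , i) (v , y , j) = E u v ∧ 𝓔 u v i j ∧ π u v x y

numEdgesG̃ : (n N : ℕ) → (Fin n → Fin n → Bool) → (Fin n → Fin n → Fin N → Fin N → Bool) → ℕ
numEdgesG̃ n N E 𝓔 = countRel (pairsFin n N) (EG̃ E 𝓔)

valueQAP : (n k N : ℕ) → (E : Fin n → Fin n → Bool) → (π : Fin n → Fin n → Fin k → Fin k → Bool) →
           (𝓔 : Fin n → Fin n → Fin N → Fin N → Bool) → (VG̃ n N → VH̃ n k N) → ℕ
valueQAP n k N E π 𝓔 φ =
  countRel (pairsFin n N) (λ a b → EG̃ E 𝓔 a b ∧ EH̃ E π 𝓔 (φ a) (φ b))

InjectiveMap : {A B : Set} → (A → B) → Set
InjectiveMap φ = Injective _≡_ _≡_ φ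

-- A satisfying labeling Λ of the label cover instance plants a copy of G̃ inside H̃:
-- (u , i) ↦ (u , Λ u , i) is injective and sends every edge of G̃ to an edge of H̃,
-- so it scores every edge of G̃. No map can score more than |E_G̃|, since the value
-- only counts edges of G̃; hence this map is optimal and OPT_QAP = |E_G̃|.
module Submission where

open import Defs
open import Data.Nat using (ℕ; _+_; _≤_; z≤n; s≤s)
open import Data.Nat.Properties using (m≤n⇒m≤o+n; ≤-trans; ≤-reflexive)
open import Data.Bool using (Bool; true; false; _∧_; if_then_else_)
open import Data.Bool.Properties using (∧-conicalˡ)
open import Data.Fin using (Fin)
open import Data.List using (List; []; _∷_; cartesianProduct)
open import Data.Product using (Σ; _×_; _,_)
open import Relation.Binary.PropositionalEquality using (_≡_; refl; sym; cong)

countL-mono : {A : Set} (p q : A → Bool) → (∀ x → p x ≡ true → q x ≡ true) →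
              (xs : List A) → countL p xs ≤ countL q xs
countL-mono p q p⇒q [] = z≤n
countL-mono p q p⇒q (x ∷ xs) with p x in px
... | true rewrite p⇒q x px = s≤s (countL-mono p q p⇒q xs)
... | false = m≤n⇒m≤o+n (if q x then 1 else 0) (countL-mono p q p⇒q xs)

countL-cong : {A : Set} (p q : A → Bool) → (∀ x → p x ≡ q x) →
              (xs : List A) → countL p xs ≡ countL q xs
countL-cong p q p≗q [] = refl
countL-cong p q p≗q (x ∷ xs) rewrite p≗q x = cong (_ +_) (countL-cong p q p≗q xs)

∧-implied-≡ˡ : (a b : Bool) → (a ≡ true → b ≡ true) → a ∧ b ≡ a
∧-implied-≡ˡ true  b a⇒b = a⇒b refl
∧-implied-≡ˡ false b _   = refl

module _ {n k N : ℕ} (E : Fin n → Fin n → Bool) (π : Fin n → Fin n → Fin k → Fin k → Bool)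
         (𝓔 : Fin n → Fin n → Fin N → Fin N → Bool) where

  PreservesEdges : (VG̃ n N → VH̃ n k N) → Set
  PreservesEdges φ = ∀ a b → EG̃ E 𝓔 a b ≡ true → EH̃ E π 𝓔 (φ a) (φ b) ≡ true

  private
    isEdge : VG̃ n N × VG̃ n N → Bool
    isEdge (a , b) = EG̃ E 𝓔 a b

    isScored : (VG̃ n N → VH̃ n k N) → VG̃ n N × VG̃ n N → Bool
    isScored φ (a , b) = EG̃ E 𝓔 a b ∧ EH̃ E π 𝓔 (φ a) (φ b)

    vertexPairs : List (VG̃ n N × VG̃ n N)
    vertexPairs = cartesianProduct (pairsFin n N) (pairsFin n N)

  valueQAP≤numEdgesG̃ : (ψ : VG̃ n N → VH̃ n k N) →
                       valueQAP n k N E π 𝓔 ψ ≤ numEdgesG̃ n N E 𝓔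
  valueQAP≤numEdgesG̃ ψ =
    countL-mono (isScored ψ) isEdge (λ (a , b) → ∧-conicalˡ _ _) vertexPairs

  valueQAP≡numEdgesG̃ : (φ : VG̃ n N → VH̃ n k N) → PreservesEdges φ →
                       valueQAP n k N E π 𝓔 φ ≡ numEdgesG̃ n N E 𝓔
  valueQAP≡numEdgesG̃ φ preserves =
    countL-cong (isScored φ) isEdge (λ (a , b) → ∧-implied-≡ˡ _ _ (preserves a b)) vertexPairs

  plant : (Fin n → Fin k) → VG̃ n N → VH̃ n k N
  plant Λ (u , i) = u , Λ u , i

  plant-injective : (Λ : Fin n → Fin k) → InjectiveMap (plant Λ)
  plant-injective Λ {u , i} {.u , .i} refl = refl

  plant-preservesEdges : (Λ : Fin n → Fin k) →
                         (∀ u v → E u v ≡ true → π u v (Λ u) (Λ v) ≡ true) →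
                         PreservesEdges (plant Λ)
  plant-preservesEdges Λ sat (u , i) (v , j) _ with E u v in uv | 𝓔 u v i j
  ... | true | true rewrite sat u v uv = refl

mainTheorem5 : (n k : ℕ) (E : Fin n → Fin n → Bool)
    (π : Fin n → Fin n → Fin k → Fin k → Bool) →
    Satisfiable n k E π →
    (𝓔 : Fin n → Fin n → Fin (redN n k E) → Fin (redN n k E) → Bool) →
    Σ (VG̃ n (redN n k E) → VH̃ n k (redN n k E)) (λ φ →
      InjectiveMap φ ×
      (∀ a b → EG̃ E 𝓔 a b ≡ true → EH̃ E π 𝓔 (φ a) (φ b) ≡ true) ×
      (valueQAP n k (redN n k E) E π 𝓔 φ ≡ numEdgesG̃ n (redN n k E) E 𝓔) ×
      ((ψ : VG̃ n (redN n k E) → VH̃ n k (redN n k E)) → InjectiveMap ψ →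
        valueQAP n k (redN n k E) E π 𝓔 ψ ≤ valueQAP n k (redN n k E) E π 𝓔 φ))
mainTheorem5 n k E π (Λ , sat) 𝓔 =
  φ , plant-injective E π 𝓔 Λ , preserves , optimal , λ ψ _ → bounded ψ
  where
  N : ℕ
  N = redN n k E

  φ : VG̃ n N → VH̃ n k N
  φ = plant E π 𝓔 Λ

  preserves : PreservesEdges E π 𝓔 φ
  preserves = plant-preservesEdges E π 𝓔 Λ sat

  optimal : valueQAP n k N E π 𝓔 φ ≡ numEdgesG̃ n N E 𝓔
  optimal = valueQAP≡numEdgesG̃ E π 𝓔 φ preserves

  bounded : (ψ : VG̃ n N → VH̃ n k N) → valueQAP n k N E π 𝓔 ψ ≤ valueQAP n k N E π 𝓔 φ
  bounded ψ = ≤-trans (valueQAP≤numEdgesG̃ E π 𝓔 ψ) (≤-reflexive (sym optimal))
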